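{- Let $f:[0,1]^3\to\mathbb R$ be given by $f(x_1,x_2,x_3)=x_1+(1-x_1-x_2+x_1x_2)\,x_3$. For every $x_1,x_2,x_3\in[0,1]$ there exists a probability distribution $(p_0,\dots,p_7)$ on $\{0,1\}^3$ (characteristic of an $L$-ensemble) such that $$x_1=p_4+p_5+p_6+p_7,\quad x_2=p_2+p_3+p_6+p_7,\quad x_3=p_1+p_3+p_5+p_7,$$ and $$z:=p_1+p_4+p_5+p_6+p_7=f(x_1,x_2,x_3).$$ -}

module Defs where

open import Level using (Level; _⊔_) renaming (suc to lsuc)
open import Algebra.Bundles using (CommutativeRing)
open import Relation.Binary.Core using (Rel)
open import Relation.Binary.Structures using (IsTotalOrder)
open import Relation.Nullary using (¬_)
open import Data.Product using (_×_; ∃)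
open import Data.Fin using (Fin; #_)

-- No real numbers in agda-stdlib: we state the result for an arbitrary
-- ordered field (ℝ is an instance).  Equality is the setoid equality ≈.
record OrderedField (c ℓ₁ ℓ₂ : Level) : Set (lsuc (c ⊔ ℓ₁ ⊔ ℓ₂)) where
  field
    commutativeRing : CommutativeRing c ℓ₁
  open CommutativeRing commutativeRing public
  infix 4 _≤_
  field
    _≤_          : Rel Carrier ℓ₂
    isTotalOrder : IsTotalOrder _≈_ _≤_
    +-monoˡ-≤    : ∀ {a b} c → a ≤ b → a + c ≤ b + c
    *-nonneg     : ∀ {a b} → 0# ≤ a → 0# ≤ b → 0# ≤ a * b
    0≉1          : ¬ (0# ≈ 1#)
    inverse      : ∀ x → ¬ (x ≈ 0#) → ∃ λ y → x * y ≈ 1#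

module _ {c ℓ₁ ℓ₂} (F : OrderedField c ℓ₁ ℓ₂) where
  open OrderedField F

  InUnit : Carrier → Set ℓ₂
  InUnit x = (0# ≤ x) × (x ≤ 1#)

  f : Carrier → Carrier → Carrier → Carrier
  f x₁ x₂ x₃ = x₁ + (1# - x₁ - x₂ + x₁ * x₂) * x₃

  -- p : {0,1}³ → F, indexed by Fin 8 via binary encoding
  -- (index 4a+2b+c ↔ (a,b,c)); a probability distribution.
  IsProbDist : (Fin 8 → Carrier) → Set (ℓ₁ ⊔ ℓ₂)
  IsProbDist p =
    (∀ i → 0# ≤ p i) ×
    (p (# 0) + p (# 1) + p (# 2) + p (# 3) + p (# 4) + p (# 5) + p (# 6) + p (# 7) ≈ 1#)

{-# OPTIONS --safe #-}
-- Take p to be the law of three independent coins X₁, X₂, X₃ with P(Xᵢ = 1) = xᵢ,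
-- i.e. p(a,b,c) = P(X₁ = a) P(X₂ = b) P(X₃ = c). Its marginals are x₁, x₂, x₃, and
-- z is the probability of the event X₁ = 1 ∨ (X₂ = 0 ∧ X₃ = 1), which is
-- x₁ + (1 - x₁)(1 - x₂) x₃ = f(x₁, x₂, x₃).
module Submission where

open import Defs
open import Algebra.Bundles using (CommutativeSemiring; CommutativeRing)
open import Data.Fin using (Fin; #_; zero; suc; remQuot)
open import Data.Product using (_×_; ∃; _,_)
open import Relation.Binary.Structures using (IsTotalOrder)
import Algebra.Properties.Ring as RingProperties
import Algebra.Solver.Ring.NaturalCoefficients.Default as SemiringSolver
import Relation.Binary.Reasoning.Setoid as SetoidReasoning

toBits : Fin 8 → Fin 2 × Fin 2 × Fin 2
toBits i = let a , j = remQuot {2} 4 i in a , remQuot {2} 2 j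

module ProductOfTwoPointWeights {c ℓ} (S : CommutativeSemiring c ℓ) where
  open CommutativeSemiring S
  open SemiringSolver S using (solve; _:=_; _:+_; _:*_)

  product : (Fin 2 → Carrier) → (Fin 2 → Carrier) → (Fin 2 → Carrier) → Fin 8 → Carrier
  product q₁ q₂ q₃ i = let a , b , c = toBits i in q₁ a * q₂ b * q₃ c

  mass : (Fin 2 → Carrier) → Carrier
  mass q = q (# 0) + q (# 1)

  module _ (q₁ q₂ q₃ : Fin 2 → Carrier) where
    private
      p : Fin 8 → Carrier
      p = product q₁ q₂ q₃

    product-total : p (# 0) + p (# 1) + p (# 2) + p (# 3) + p (# 4) + p (# 5) + p (# 6) + p (# 7)
                  ≈ mass q₁ * mass q₂ * mass q₃
    product-total = solve 6 (λ a₀ a₁ b₀ b₁ c₀ c₁ →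
        a₀ :* b₀ :* c₀ :+ a₀ :* b₀ :* c₁ :+ a₀ :* b₁ :* c₀ :+ a₀ :* b₁ :* c₁
        :+ a₁ :* b₀ :* c₀ :+ a₁ :* b₀ :* c₁ :+ a₁ :* b₁ :* c₀ :+ a₁ :* b₁ :* c₁
      := (a₀ :+ a₁) :* (b₀ :+ b₁) :* (c₀ :+ c₁))
      refl (q₁ (# 0)) (q₁ (# 1)) (q₂ (# 0)) (q₂ (# 1)) (q₃ (# 0)) (q₃ (# 1))

    product-marginal₁ : p (# 4) + p (# 5) + p (# 6) + p (# 7) ≈ q₁ (# 1) * mass q₂ * mass q₃
    product-marginal₁ = solve 5 (λ a₁ b₀ b₁ c₀ c₁ →
        a₁ :* b₀ :* c₀ :+ a₁ :* b₀ :* c₁ :+ a₁ :* b₁ :* c₀ :+ a₁ :* b₁ :* c₁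
      := a₁ :* (b₀ :+ b₁) :* (c₀ :+ c₁))
      refl (q₁ (# 1)) (q₂ (# 0)) (q₂ (# 1)) (q₃ (# 0)) (q₃ (# 1))

    product-marginal₂ : p (# 2) + p (# 3) + p (# 6) + p (# 7) ≈ q₂ (# 1) * mass q₁ * mass q₃
    product-marginal₂ = solve 5 (λ a₀ a₁ b₁ c₀ c₁ →
        a₀ :* b₁ :* c₀ :+ a₀ :* b₁ :* c₁ :+ a₁ :* b₁ :* c₀ :+ a₁ :* b₁ :* c₁
      := b₁ :* (a₀ :+ a₁) :* (c₀ :+ c₁))
      refl (q₁ (# 0)) (q₁ (# 1)) (q₂ (# 1)) (q₃ (# 0)) (q₃ (# 1))

    product-marginal₃ : p (# 1) + p (# 3) + p (# 5) + p (# 7) ≈ q₃ (# 1) * mass q₁ * mass q₂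
    product-marginal₃ = solve 5 (λ a₀ a₁ b₀ b₁ c₁ →
        a₀ :* b₀ :* c₁ :+ a₀ :* b₁ :* c₁ :+ a₁ :* b₀ :* c₁ :+ a₁ :* b₁ :* c₁
      := c₁ :* (a₀ :+ a₁) :* (b₀ :+ b₁))
      refl (q₁ (# 0)) (q₁ (# 1)) (q₂ (# 0)) (q₂ (# 1)) (q₃ (# 1))

    product-z : p (# 1) + p (# 4) + p (# 5) + p (# 6) + p (# 7)
              ≈ q₁ (# 1) * mass q₂ * mass q₃ + q₁ (# 0) * q₂ (# 0) * q₃ (# 1)
    product-z = solve 6 (λ a₀ a₁ b₀ b₁ c₀ c₁ →
        a₀ :* b₀ :* c₁ :+ a₁ :* b₀ :* c₀ :+ a₁ :* b₀ :* c₁ :+ a₁ :* b₁ :* c₀ :+ a₁ :* b₁ :* c₁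
      := a₁ :* (b₀ :+ b₁) :* (c₀ :+ c₁) :+ a₀ :* b₀ :* c₁)
      refl (q₁ (# 0)) (q₁ (# 1)) (q₂ (# 0)) (q₂ (# 1)) (q₃ (# 0)) (q₃ (# 1))

  x*u*v≈x : ∀ x {u v} → u ≈ 1# → v ≈ 1# → x * u * v ≈ x
  x*u*v≈x x {u} {v} u≈1 v≈1 = begin
    x * u * v   ≈⟨ *-cong (*-congˡ u≈1) v≈1 ⟩
    x * 1# * 1# ≈⟨ *-identityʳ (x * 1#) ⟩
    x * 1#      ≈⟨ *-identityʳ x ⟩
    x           ∎
    where open SetoidReasoning setoid

module Coins {c ℓ} (R : CommutativeRing c ℓ) where
  open CommutativeRing R
  open RingProperties ring using (-‿distribˡ-*; -‿distribʳ-*; -‿involutive; //-rightDividesˡ)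
  open ProductOfTwoPointWeights commutativeSemiring
  open SemiringSolver commutativeSemiring using (solve; _:=_; _:+_; _:*_; con)
  open SetoidReasoning setoid

  coin : Carrier → Fin 2 → Carrier
  coin x zero       = 1# - x
  coin x (suc zero) = x

  coin-mass : ∀ x → mass (coin x) ≈ 1#
  coin-mass x = //-rightDividesˡ x 1#

  -x*-y≈x*y : ∀ x y → - x * - y ≈ x * y
  -x*-y≈x*y x y = begin
    - x * - y     ≈⟨ -‿distribˡ-* x (- y) ⟨
    - (x * - y)   ≈⟨ -‿cong (-‿distribʳ-* x y) ⟨
    - - (x * y)   ≈⟨ -‿involutive (x * y) ⟩
    x * y         ∎

  -- Negation is outside the semiring solver, so - x and - y enter it as atoms.
  [1-x][1-y]≈1-x-y+xy : ∀ x y → (1# - x) * (1# - y) ≈ 1# - x - y + x * y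
  [1-x][1-y]≈1-x-y+xy x y = begin
    (1# - x) * (1# - y)      ≈⟨ solve 2 (λ x′ y′ → (con 1 :+ x′) :* (con 1 :+ y′)
                                   := con 1 :+ x′ :+ y′ :+ x′ :* y′) refl (- x) (- y) ⟩
    1# - x - y + - x * - y   ≈⟨ +-congˡ (-x*-y≈x*y x y) ⟩
    1# - x - y + x * y       ∎

  coins : Carrier → Carrier → Carrier → Fin 8 → Carrier
  coins x₁ x₂ x₃ = product (coin x₁) (coin x₂) (coin x₃)

  module _ (x₁ x₂ x₃ : Carrier) where
    private
      q₁ q₂ q₃ : Fin 2 → Carrier
      q₁ = coin x₁
      q₂ = coin x₂
      q₃ = coin x₃

      p : Fin 8 → Carrier
      p = coins x₁ x₂ x₃

      mass₁ : mass q₁ ≈ 1#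
      mass₁ = coin-mass x₁
      mass₂ : mass q₂ ≈ 1#
      mass₂ = coin-mass x₂
      mass₃ : mass q₃ ≈ 1#
      mass₃ = coin-mass x₃

    coins-total : p (# 0) + p (# 1) + p (# 2) + p (# 3) + p (# 4) + p (# 5) + p (# 6) + p (# 7) ≈ 1#
    coins-total = trans (product-total q₁ q₂ q₃) (trans (x*u*v≈x (mass q₁) mass₂ mass₃) mass₁)

    coins-marginal₁ : x₁ ≈ p (# 4) + p (# 5) + p (# 6) + p (# 7)
    coins-marginal₁ = sym (trans (product-marginal₁ q₁ q₂ q₃) (x*u*v≈x x₁ mass₂ mass₃))

    coins-marginal₂ : x₂ ≈ p (# 2) + p (# 3) + p (# 6) + p (# 7)
    coins-marginal₂ = sym (trans (product-marginal₂ q₁ q₂ q₃) (x*u*v≈x x₂ mass₁ mass₃))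

    coins-marginal₃ : x₃ ≈ p (# 1) + p (# 3) + p (# 5) + p (# 7)
    coins-marginal₃ = sym (trans (product-marginal₃ q₁ q₂ q₃) (x*u*v≈x x₃ mass₁ mass₂))

    coins-z : p (# 1) + p (# 4) + p (# 5) + p (# 6) + p (# 7)
            ≈ x₁ + (1# - x₁ - x₂ + x₁ * x₂) * x₃
    coins-z = trans (product-z q₁ q₂ q₃)
      (+-cong (x*u*v≈x x₁ mass₂ mass₃) (*-congʳ ([1-x][1-y]≈1-x-y+xy x₁ x₂)))

module OrderedCoins {c ℓ₁ ℓ₂} (F : OrderedField c ℓ₁ ℓ₂) where
  open OrderedField F
  open IsTotalOrder isTotalOrder using (≲-respˡ-≈)
  open ProductOfTwoPointWeights commutativeSemiring using (product)
  open Coins commutativeRing using (coin; coins)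

  coin-nonneg : ∀ {x} → InUnit F x → ∀ b → 0# ≤ coin x b
  coin-nonneg (_   , x≤1) zero       = ≲-respˡ-≈ (-‿inverseʳ _) (+-monoˡ-≤ _ x≤1)
  coin-nonneg (0≤x , _  ) (suc zero) = 0≤x

  product-nonneg : ∀ {q₁ q₂ q₃} →
                   (∀ a → 0# ≤ q₁ a) → (∀ b → 0# ≤ q₂ b) → (∀ c → 0# ≤ q₃ c) →
                   ∀ i → 0# ≤ product q₁ q₂ q₃ i
  product-nonneg q₁≥0 q₂≥0 q₃≥0 i =
    let a , b , c = toBits i in *-nonneg (*-nonneg (q₁≥0 a) (q₂≥0 b)) (q₃≥0 c)

  coins-nonneg : ∀ {x₁ x₂ x₃} → InUnit F x₁ → InUnit F x₂ → InUnit F x₃ →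
                 ∀ i → 0# ≤ coins x₁ x₂ x₃ i
  coins-nonneg x₁∈I x₂∈I x₃∈I =
    product-nonneg (coin-nonneg x₁∈I) (coin-nonneg x₂∈I) (coin-nonneg x₃∈I)

theorem4 : ∀ {c ℓ₁ ℓ₂} (F : OrderedField c ℓ₁ ℓ₂) → let open OrderedField F in
    ∀ x₁ x₂ x₃ → InUnit F x₁ → InUnit F x₂ → InUnit F x₃ →
    ∃ λ (p : Fin 8 → Carrier) →
      IsProbDist F p ×
      (x₁ ≈ p (# 4) + p (# 5) + p (# 6) + p (# 7)) ×
      (x₂ ≈ p (# 2) + p (# 3) + p (# 6) + p (# 7)) ×
      (x₃ ≈ p (# 1) + p (# 3) + p (# 5) + p (# 7)) ×
      (p (# 1) + p (# 4) + p (# 5) + p (# 6) + p (# 7) ≈ f F x₁ x₂ x₃)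
theorem4 F x₁ x₂ x₃ x₁∈I x₂∈I x₃∈I =
  coins x₁ x₂ x₃ ,
  (coins-nonneg x₁∈I x₂∈I x₃∈I , coins-total x₁ x₂ x₃) ,
  coins-marginal₁ x₁ x₂ x₃ , coins-marginal₂ x₁ x₂ x₃ , coins-marginal₃ x₁ x₂ x₃ ,
  coins-z x₁ x₂ x₃
  where
  open OrderedField F
  open Coins commutativeRing
  open OrderedCoins F
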